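{- Let $(A,d_A)$, $(B,d_B)$, $(C,d_C)$ be premetric spaces, let $f:A\to B$ be an isometric embedding, and let $h:A\to C$ be an isometric embedding with dense image. Then there exists a unique isometric embedding $g:C\to\widehat{B}$ such that $g\circ h=i\circ f$, where $i:B\to\widehat{B}$ is the map $i(b)=b^*$.
   Context: A premetric on a nonempty set $X$ is a relation $d$ between $X\times X$ and the nonnegative rationals, written $d(x,y)\leq q$, such that for all $x,y,z\in X$ and nonnegative rationals $p,q$: (1) $d(x,y)\leq 0$ iff $x=y$; (2) $d(x,y)\leq q$ implies $d(y,x)\leq q$; (3) $d(x,z)\leq p$ and $d(z,y)\leq q$ imply $d(x,y)\leq p+q$; (4) $d(x,y)\leq p$ iff $d(x,y)\leq q$ for all rationals $q>p$. For $S\subseteq X$, $\operatorname{diam} S\leq q$ means $d(x,y)\leq q$ for all $x,y\in S$. A Cauchy family on $X$ is $F\subseteq\mathcal{P}(X)$ with (i) $S\cap T\neq\emptyset$ for all $S,T\in F$ and (ii) for every rational $\varepsilon>0$ some $S\in F$ has $\operatorname{diam} S\leq\varepsilon$. For Cauchy families $F,F'$, $d(F,F')\leq q$ means: for every rational $\varepsilon>0$ there exist $S\in F$, $T\in F'$ with $\operatorname{diam} S,\operatorname{diam} T\leq\varepsilon$ and $\operatorname{diam}(S\cup T)\leq q+\varepsilon$. This is a pseudo-premetric; $F\sim F'$ iff $d(F,F')\leq 0$ is an equivalence relation; $\widehat{X}$ is the set of classes $[F]$ with premetric $\widehat{d}([F],[F'])\leq q$ iff $d(F,F')\leq q$; $x^*$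 denotes the class of $\{\{x\}\}$. A map $f:(X,d_X)\to(Y,d_Y)$ is an isometric embedding if $d_X(x,x')\leq q\iff d_Y(f(x),f(x'))\leq q$ for all $x,x'$ and nonnegative rationals $q$. A subset $D\subseteq Y$ is dense if for every rational $\varepsilon>0$ and $y\in Y$ there is $z\in D$ with $d_Y(z,y)\leq\varepsilon$. -}

module Defs where

open import Level using (_⊔_)
open import Data.Rational using (ℚ; 0ℚ; _≤_; _<_; _+_)
open import Data.Product using (Σ; _×_; ∃; ∃-syntax; _,_)
open import Relation.Binary.Structures using (IsEquivalence)
open import Function.Bundles using (_⇔_; mk⇔; Equivalence)
open import Data.Sum using (_⊎_)
open import Data.Rational.Properties using (≤-refl)

-- A premetric space: a set (in the Bishop sense, i.e. a type with an
-- equivalence relation as its equality) together with a relation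
-- d x y q  read as  "d(x,y) ≤ q", only meaningful for q ≥ 0.
record PremetricSpace : Set₁ where
  field
    Carrier : Set
    _≈_     : Carrier → Carrier → Set
    isEquivalence : IsEquivalence _≈_
    d       : Carrier → Carrier → ℚ → Set
    d-zero  : ∀ x y → d x y 0ℚ ⇔ (x ≈ y)
    d-sym   : ∀ x y q → 0ℚ ≤ q → d x y q → d y x q
    d-tri   : ∀ x y z p q → 0ℚ ≤ p → 0ℚ ≤ q →
              d x z p → d z y q → d x y (p + q)
    d-round : ∀ x y p → 0ℚ ≤ p → d x y p ⇔ (∀ q → p < q → d x y q)

module _ (X : PremetricSpace) where
  open PremetricSpace X

  Subset : Set₁
  Subset = Carrier → Set

  Diam≤ : Subset → ℚ → Set
  Diam≤ S q = ∀ x y → S x → S y → d x y q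

  _∪_ : Subset → Subset → Subset
  (S ∪ T) x = S x ⊎ T x

  Family : Set₁
  Family = Subset → Set

  record IsCauchy (F : Family) : Set₁ where
    field
      meets : ∀ S T → F S → F T → ∃[ x ] (S x × T x)
      small : ∀ ε → 0ℚ < ε → ∃[ S ] (F S × Diam≤ S ε)

  CauchyFamily : Set₁
  CauchyFamily = Σ Family IsCauchy

  dFam : CauchyFamily → CauchyFamily → ℚ → Set₁
  dFam (F , _) (F' , _) q =
    ∀ ε → 0ℚ < ε →
      ∃[ S ] ∃[ T ] (F S × F' T × Diam≤ S ε × Diam≤ T ε × Diam≤ (S ∪ T) (q + ε))

  -- equality in the completion: F ~ F' iff d(F,F') ≤ 0
  _~_ : CauchyFamily → CauchyFamily → Set₁
  F ~ F' = dFam F F' 0ℚ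

  -- x* : the class of {{x}}  (the family whose only member is the singleton {x})
  singletonFamily : Carrier → CauchyFamily
  singletonFamily x = F , record { meets = meets ; small = small }
    where
      open IsEquivalence isEquivalence using (refl; sym; trans)
      F : Family
      F S = ∀ y → S y ⇔ (x ≈ y)
      meets : ∀ S T → F S → F T → ∃[ y ] (S y × T y)
      meets S T FS FT = x , (Equivalence.from (FS x) refl , Equivalence.from (FT x) refl)
      small : ∀ ε → 0ℚ < ε → ∃[ S ] (F S × Diam≤ S ε)
      small ε 0<ε = (λ y → x ≈ y) , (λ y → mk⇔ (λ p → p) (λ p → p)) , diam
        where
          diam : Diam≤ (λ y → x ≈ y) ε
          diam y z xy xz =
            Equivalence.to (d-round y z 0ℚ ≤-refl)
              (Equivalence.from (d-zero y z) (trans (sym xy) xz)) ε 0<ε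

IsIsometricEmbedding : ∀ {a b ℓ₁ ℓ₂} {X : Set a} {Y : Set b} →
  (X → X → ℚ → Set ℓ₁) → (Y → Y → ℚ → Set ℓ₂) → (X → Y) → Set (a ⊔ ℓ₁ ⊔ ℓ₂)
IsIsometricEmbedding dX dY f =
  ∀ x x' q → 0ℚ ≤ q → dX x x' q ⇔ dY (f x) (f x') q

HasDenseImage : ∀ {a b ℓ} {X : Set a} {Y : Set b} →
  (Y → Y → ℚ → Set ℓ) → (X → Y) → Set (a ⊔ b ⊔ ℓ)
HasDenseImage dY h = ∀ ε → 0ℚ < ε → ∀ y → ∃[ x ] dY (h x) y ε

module Submission where

-- The extension sends c to the family of sets f(h⁻¹(ball(c,δ))), δ > 0, which is Cauchy because
-- h has dense image, and the distance between two such families is that of their centres because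
-- f and h are isometric. For uniqueness, any other isometric extension g′ agrees with it on h(A)
-- up to ~, so the triangle inequality in the completion gives d(g′c, gc) ≤ 2 d(c, h a), which
-- density makes arbitrarily small.

open import Defs
open import Data.Product using (_×_; ∃; ∃-syntax; _,_)

open import Data.Integer using (+_)
open import Data.Rational using (ℚ; 0ℚ; _≤_; _<_; _+_; _*_; _-_; -_; ½; _/_)
import Data.Rational.Properties as ℚ
open import Data.Rational.Solver using (module +-*-Solver)
open import Data.Sum using (inj₁; inj₂; swap)
open import Function.Base using (id; _∘_)
open import Function.Bundles using (_⇔_; mk⇔; Equivalence)
open import Relation.Binary.PropositionalEquality using (_≡_; refl; sym; trans; subst)
open import Relation.Binary.Structures using (IsEquivalence)
open Equivalence using (to; from)

module Splitting where
  open +-*-Solver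

  half : ℚ → ℚ
  half ε = ε * ½

  half-pos : ∀ {ε} → 0ℚ < ε → 0ℚ < half ε
  half-pos = ℚ.*-monoˡ-<-pos ½

  half-nonNeg : ∀ {ε} → 0ℚ ≤ ε → 0ℚ ≤ half ε
  half-nonNeg = ℚ.*-monoʳ-≤-nonNeg ½

  half+half : ∀ ε → half ε + half ε ≡ ε
  half+half = solve 1 (λ ε → ε :* con ½ :+ ε :* con ½ := ε) refl

  +-nonNeg : ∀ {p q} → 0ℚ ≤ p → 0ℚ ≤ q → 0ℚ ≤ p + q
  +-nonNeg = ℚ.+-mono-≤

  ≤-+ˡ : ∀ {p} r → 0ℚ ≤ r → p ≤ r + p
  ≤-+ˡ {p} r 0≤r = subst (_≤ r + p) (ℚ.+-identityˡ p) (ℚ.+-mono-≤ 0≤r ℚ.≤-refl)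

  half≤ : ∀ {ε} → 0ℚ ≤ ε → half ε ≤ ε
  half≤ {ε} 0≤ε = subst (half ε ≤_) (half+half ε) (≤-+ˡ (half ε) (half-nonNeg 0≤ε))

  third-of-gap : ℚ → ℚ → ℚ
  third-of-gap q r = (r - q) * (+ 1 / 3)

  third-of-gap-pos : ∀ {q r} → q < r → 0ℚ < third-of-gap q r
  third-of-gap-pos {q} {r} q<r =
    ℚ.*-monoˡ-<-pos (+ 1 / 3) (subst (_< r - q) (ℚ.+-inverseʳ q) (ℚ.+-monoˡ-< (- q) q<r))

  third-of-gap-sum : ∀ q r → let ε = third-of-gap q r in ε + (q + ε) + ε ≡ r
  third-of-gap-sum = solve 2 (λ q r → let ε = (r :- q) :* con (+ 1 / 3) in ε :+ (q :+ ε) :+ ε := r) refl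

open Splitting

module PremetricProperties (X : PremetricSpace) where
  open PremetricSpace X

  d-mono : ∀ {x y p q} → 0ℚ ≤ p → p ≤ q → d x y p → d x y q
  d-mono {x} {y} {p} {q} 0≤p p≤q dp =
    from (d-round x y q (ℚ.≤-trans 0≤p p≤q)) λ r q<r → to (d-round x y p 0≤p) dp r (ℚ.≤-<-trans p≤q q<r)

  ≈⇒d : ∀ {x y ε} → 0ℚ ≤ ε → x ≈ y → d x y ε
  ≈⇒d {x} {y} 0≤ε x≈y = d-mono ℚ.≤-refl 0≤ε (from (d-zero x y) x≈y)

  d-refl : ∀ x → d x x 0ℚ
  d-refl x = from (d-zero x x) (IsEquivalence.refl isEquivalence)

  symmetric : ∀ {x y q} → 0ℚ ≤ q → d x y q → d y x q
  symmetric {x} {y} {q} = d-sym x y q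

  triangle : ∀ {x z y p q} → 0ℚ ≤ p → 0ℚ ≤ q → d x z p → d z y q → d x y (p + q)
  triangle {x} {z} {y} {p} {q} = d-tri x y z p q

  d-respʳ-≈ : ∀ {x y z q} → 0ℚ ≤ q → d x y q → y ≈ z → d x z q
  d-respʳ-≈ {x} {y} {z} {q} 0≤q dxy y≈z =
    subst (d x z) (ℚ.+-identityʳ q) (triangle 0≤q ℚ.≤-refl dxy (from (d-zero y z) y≈z))

  Diam-mono : ∀ {S p q} → 0ℚ ≤ p → p ≤ q → Diam≤ X S p → Diam≤ X S q
  Diam-mono 0≤p p≤q diamS x y Sx Sy = d-mono 0≤p p≤q (diamS x y Sx Sy)

  Diam-∪ : ∀ {S T s} → 0ℚ ≤ s → Diam≤ X S s → Diam≤ X T s →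
    (∀ x y → S x → T y → d x y s) → Diam≤ X (_∪_ X S T) s
  Diam-∪ 0≤s diamS diamT cross x y (inj₁ Sx) (inj₁ Sy) = diamS x y Sx Sy
  Diam-∪ 0≤s diamS diamT cross x y (inj₂ Tx) (inj₂ Ty) = diamT x y Tx Ty
  Diam-∪ 0≤s diamS diamT cross x y (inj₁ Sx) (inj₂ Ty) = cross x y Sx Ty
  Diam-∪ 0≤s diamS diamT cross x y (inj₂ Tx) (inj₁ Sy) = symmetric 0≤s (cross y x Sy Tx)

  dFam-sym : ∀ {F G q} → dFam X F G q → dFam X G F q
  dFam-sym FG ε 0<ε =
    let (S , T , FS , GT , diamS , diamT , diamS∪T) = FG ε 0<ε
    in T , S , GT , FS , diamT , diamS , λ x y Tx Ty → diamS∪T x y (swap Tx) (swap Ty)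

  -- The two witnessing sets chosen for G overlap since G is Cauchy; a common point links the two estimates.
  dFam-trans : ∀ {F G H p q} → 0ℚ ≤ p → 0ℚ ≤ q →
    dFam X F G p → dFam X G H q → dFam X F H (p + q)
  dFam-trans {G = _ , G-cauchy} {p = p} {q} 0≤p 0≤q FG GH ε 0<ε
    with FG (half ε) (half-pos 0<ε) | GH (half ε) (half-pos 0<ε)
  ... | S , T , FS , GT , diamS , _ , diamS∪T | T′ , U , GT′ , HU , _ , diamU , diamT′∪U
    with IsCauchy.meets G-cauchy T T′ GT GT′
  ... | z , Tz , T′z =
    S , U , FS , HU , Diam-mono 0≤ε/2 (half≤ 0≤ε) diamS , Diam-mono 0≤ε/2 (half≤ 0≤ε) diamU ,
    Diam-∪ (+-nonNeg 0≤p+q 0≤ε) (Diam-mono 0≤ε/2 ε/2≤ diamS) (Diam-mono 0≤ε/2 ε/2≤ diamU) cross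
    where
      open +-*-Solver
      0≤ε : 0ℚ ≤ ε
      0≤ε = ℚ.<⇒≤ 0<ε
      0≤ε/2 : 0ℚ ≤ half ε
      0≤ε/2 = half-nonNeg 0≤ε
      0≤p+q : 0ℚ ≤ p + q
      0≤p+q = +-nonNeg 0≤p 0≤q
      ε/2≤ : half ε ≤ (p + q) + ε
      ε/2≤ = ℚ.≤-trans (half≤ 0≤ε) (≤-+ˡ (p + q) 0≤p+q)
      regroup : ∀ p q ε → (p + half ε) + (q + half ε) ≡ (p + q) + ε
      regroup = solve 3 (λ p q ε → (p :+ ε :* con ½) :+ (q :+ ε :* con ½) := (p :+ q) :+ ε) refl
      cross : ∀ x y → S x → U y → d x y ((p + q) + ε)
      cross x y Sx Uy = subst (d x y) (regroup p q ε)
        (triangle (+-nonNeg 0≤p 0≤ε/2) (+-nonNeg 0≤q 0≤ε/2)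
          (diamS∪T x z (inj₁ Sx) (inj₂ Tz)) (diamT′∪U z y (inj₁ T′z) (inj₂ Uy)))

  ~-fromArbitrarilyClose : ∀ {F G} → (∀ ε → 0ℚ < ε → dFam X F G ε) → _~_ X F G
  ~-fromArbitrarilyClose FG ε 0<ε =
    let (S , T , FS , GT , diamS , diamT , diamS∪T) = FG (half ε) (half-pos 0<ε) (half ε) (half-pos 0<ε)
        0≤ε = ℚ.<⇒≤ 0<ε
        ε/2+ε/2≡0+ε = trans (half+half ε) (sym (ℚ.+-identityˡ ε))
    in S , T , FS , GT , Diam-mono (half-nonNeg 0≤ε) (half≤ 0≤ε) diamS ,
       Diam-mono (half-nonNeg 0≤ε) (half≤ 0≤ε) diamT ,
       λ x y Sx∪Tx Sy∪Ty → subst (d x y) ε/2+ε/2≡0+ε (diamS∪T x y Sx∪Tx Sy∪Ty)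

open PremetricSpace using (Carrier; d)

module Extension (A B C : PremetricSpace)
    (f : Carrier A → Carrier B) (h : Carrier A → Carrier C)
    (f-iso : IsIsometricEmbedding (d A) (d B) f)
    (h-iso : IsIsometricEmbedding (d A) (d C) h)
    (h-dense : HasDenseImage (d C) h) where

  private
    module B = PremetricSpace B
    module C = PremetricSpace C
    module PB = PremetricProperties B
    module PC = PremetricProperties C

  h⇒f : ∀ {a a′ q} → 0ℚ ≤ q → d C (h a) (h a′) q → d B (f a) (f a′) q
  h⇒f {a} {a′} {q} 0≤q = to (f-iso a a′ q 0≤q) ∘ from (h-iso a a′ q 0≤q)

  f⇒h : ∀ {a a′ q} → 0ℚ ≤ q → d B (f a) (f a′) q → d C (h a) (h a′) q
  f⇒h {a} {a′} {q} 0≤q = to (h-iso a a′ q 0≤q) ∘ from (f-iso a a′ q 0≤q)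

  Ball : Carrier C → ℚ → Subset B
  Ball c δ b = ∃[ a ] (f a ≡ b × d C (h a) c δ)

  ballFamily : Carrier C → Family B
  ballFamily c S = ∃[ δ ] (0ℚ < δ × (∀ b → S b ⇔ Ball c δ b))

  Ball∈ballFamily : ∀ c {δ} → 0ℚ < δ → ballFamily c (Ball c δ)
  Ball∈ballFamily c {δ} 0<δ = δ , 0<δ , λ b → mk⇔ id id

  Ball-dist : ∀ {c c′ δ δ′ q b b′} → 0ℚ ≤ δ → 0ℚ ≤ q → 0ℚ ≤ δ′ →
    Ball c δ b → Ball c′ δ′ b′ → d C c c′ q → d B b b′ (δ + q + δ′)
  Ball-dist 0≤δ 0≤q 0≤δ′ (a , refl , d[ha,c]) (a′ , refl , d[ha′,c′]) d[c,c′] =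
    h⇒f (+-nonNeg (+-nonNeg 0≤δ 0≤q) 0≤δ′)
      (PC.triangle (+-nonNeg 0≤δ 0≤q) 0≤δ′ (PC.triangle 0≤δ 0≤q d[ha,c] d[c,c′]) (PC.symmetric 0≤δ′ d[ha′,c′]))

  Ball-diam : ∀ c {ε} → 0ℚ < ε → Diam≤ B (Ball c (half ε)) ε
  Ball-diam c {ε} 0<ε x y Bx By =
    subst (d B x y) (regroup ε) (Ball-dist 0≤ε/2 ℚ.≤-refl 0≤ε/2 Bx By (PC.d-refl c))
    where
      open +-*-Solver
      0≤ε/2 : 0ℚ ≤ half ε
      0≤ε/2 = half-nonNeg (ℚ.<⇒≤ 0<ε)
      regroup : ∀ ε → half ε + 0ℚ + half ε ≡ ε
      regroup = solve 1 (λ ε → ε :* con ½ :+ con 0ℚ :+ ε :* con ½ := ε) refl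

  nearBoth : ∀ c {δ δ′} → 0ℚ < δ → 0ℚ < δ′ → ∃[ a ] (d C (h a) c δ × d C (h a) c δ′)
  nearBoth c {δ} {δ′} 0<δ 0<δ′ with ℚ.≤-total δ δ′
  ... | inj₁ δ≤δ′ = let (a , d[ha,c]) = h-dense δ 0<δ c in a , d[ha,c] , PC.d-mono (ℚ.<⇒≤ 0<δ) δ≤δ′ d[ha,c]
  ... | inj₂ δ′≤δ = let (a , d[ha,c]) = h-dense δ′ 0<δ′ c in a , PC.d-mono (ℚ.<⇒≤ 0<δ′) δ′≤δ d[ha,c] , d[ha,c]

  ballFamily-cauchy : ∀ c → IsCauchy B (ballFamily c)
  ballFamily-cauchy c = record { meets = meets ; small = small }
    where
      meets : ∀ S T → ballFamily c S → ballFamily c T → ∃[ b ] (S b × T b)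
      meets S T (δ , 0<δ , S≐Ball) (δ′ , 0<δ′ , T≐Ball) =
        let (a , d[ha,c]≤δ , d[ha,c]≤δ′) = nearBoth c 0<δ 0<δ′
        in f a , from (S≐Ball (f a)) (a , refl , d[ha,c]≤δ) , from (T≐Ball (f a)) (a , refl , d[ha,c]≤δ′)
      small : ∀ ε → 0ℚ < ε → ∃[ S ] (ballFamily c S × Diam≤ B S ε)
      small ε 0<ε = Ball c (half ε) , Ball∈ballFamily c (half-pos 0<ε) , Ball-diam c 0<ε

  extension : Carrier C → CauchyFamily B
  extension c = ballFamily c , ballFamily-cauchy c

  extension-nonexpanding : ∀ {c c′ q} → 0ℚ ≤ q → d C c c′ q → dFam B (extension c) (extension c′) q
  extension-nonexpanding {c} {c′} {q} 0≤q d[c,c′] ε 0<ε =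
    Ball c (half ε) , Ball c′ (half ε) ,
    Ball∈ballFamily c (half-pos 0<ε) , Ball∈ballFamily c′ (half-pos 0<ε) ,
    Ball-diam c 0<ε , Ball-diam c′ 0<ε ,
    PB.Diam-∪ (+-nonNeg 0≤q 0≤ε) (PB.Diam-mono 0≤ε ε≤q+ε (Ball-diam c 0<ε))
      (PB.Diam-mono 0≤ε ε≤q+ε (Ball-diam c′ 0<ε)) cross
    where
      open +-*-Solver
      0≤ε : 0ℚ ≤ ε
      0≤ε = ℚ.<⇒≤ 0<ε
      ε≤q+ε : ε ≤ q + ε
      ε≤q+ε = ≤-+ˡ q 0≤q
      regroup : ∀ q ε → half ε + q + half ε ≡ q + ε
      regroup = solve 2 (λ q ε → ε :* con ½ :+ q :+ ε :* con ½ := q :+ ε) refl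
      cross : ∀ x y → Ball c (half ε) x → Ball c′ (half ε) y → d B x y (q + ε)
      cross x y Bx By = subst (d B x y) (regroup q ε)
        (Ball-dist (half-nonNeg 0≤ε) 0≤q (half-nonNeg 0≤ε) Bx By d[c,c′])

  -- For r > q take ε = (r - q)/3 and points h a, h a′ within ε of c, c′ whose f-images lie in
  -- the witnessing sets; then d(c,c′) ≤ ε + (q + ε) + ε = r.
  extension-noncontracting : ∀ {c c′ q} → 0ℚ ≤ q → dFam B (extension c) (extension c′) q → d C c c′ q
  extension-noncontracting {c} {c′} {q} 0≤q gc~gc′ = from (C.d-round c c′ q 0≤q) λ r q<r →
    let ε = third-of-gap q r
        0<ε = third-of-gap-pos q<r
        0≤ε = ℚ.<⇒≤ 0<ε
        (S , T , (δ , 0<δ , S≐Ball) , (δ′ , 0<δ′ , T≐Ball) , _ , _ , diamS∪T) = gc~gc′ ε 0<ε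
        (a , d[ha,c]≤δ , d[ha,c]≤ε) = nearBoth c 0<δ 0<ε
        (a′ , d[ha′,c′]≤δ′ , d[ha′,c′]≤ε) = nearBoth c′ 0<δ′ 0<ε
        fa∈S = from (S≐Ball (f a)) (a , refl , d[ha,c]≤δ)
        fa′∈T = from (T≐Ball (f a′)) (a′ , refl , d[ha′,c′]≤δ′)
        d[ha,ha′] = f⇒h (+-nonNeg 0≤q 0≤ε) (diamS∪T (f a) (f a′) (inj₁ fa∈S) (inj₂ fa′∈T))
    in subst (d C c c′) (third-of-gap-sum q r)
         (PC.triangle (+-nonNeg 0≤ε (+-nonNeg 0≤q 0≤ε)) 0≤ε
           (PC.triangle 0≤ε (+-nonNeg 0≤q 0≤ε) (PC.symmetric 0≤ε d[ha,c]≤ε) d[ha,ha′])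
           d[ha′,c′]≤ε)

  extension-isometric : IsIsometricEmbedding (d C) (dFam B) extension
  extension-isometric c c′ q 0≤q = mk⇔ (extension-nonexpanding 0≤q) (extension-noncontracting 0≤q)

  extension-extends : ∀ a → _~_ B (extension (h a)) (singletonFamily B (f a))
  extension-extends a ε 0<ε =
    Ball (h a) (half ε) , (B._≈_ (f a)) ,
    Ball∈ballFamily (h a) (half-pos 0<ε) , (λ b → mk⇔ id id) ,
    Ball-diam (h a) 0<ε , diam≈fa ,
    PB.Diam-∪ (+-nonNeg ℚ.≤-refl 0≤ε) (PB.Diam-mono 0≤ε ε≤0+ε (Ball-diam (h a) 0<ε))
      (PB.Diam-mono 0≤ε ε≤0+ε diam≈fa) cross
    where
      open IsEquivalence B.isEquivalence using () renaming (sym to ≈-sym; trans to ≈-trans)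
      0≤ε : 0ℚ ≤ ε
      0≤ε = ℚ.<⇒≤ 0<ε
      0≤ε/2 : 0ℚ ≤ half ε
      0≤ε/2 = half-nonNeg 0≤ε
      ε≤0+ε : ε ≤ 0ℚ + ε
      ε≤0+ε = ≤-+ˡ 0ℚ ℚ.≤-refl
      diam≈fa : Diam≤ B (B._≈_ (f a)) ε
      diam≈fa x y fa≈x fa≈y = PB.≈⇒d 0≤ε (≈-trans (≈-sym fa≈x) fa≈y)
      cross : ∀ x y → Ball (h a) (half ε) x → B._≈_ (f a) y → d B x y (0ℚ + ε)
      cross x y (a′ , refl , d[ha′,ha]) fa≈y =
        PB.d-mono 0≤ε/2 (ℚ.≤-trans (half≤ 0≤ε) ε≤0+ε) (PB.d-respʳ-≈ 0≤ε/2 (h⇒f 0≤ε/2 d[ha′,ha]) fa≈y)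

  extension-unique : ∀ (g′ : Carrier C → CauchyFamily B) →
    IsIsometricEmbedding (d C) (dFam B) g′ →
    (∀ a → _~_ B (g′ (h a)) (singletonFamily B (f a))) →
    ∀ c → _~_ B (g′ c) (extension c)
  extension-unique g′ g′-iso g′-extends c = PB.~-fromArbitrarilyClose {g′ c} {extension c} λ ε 0<ε →
    let δ = half ε
        0≤δ = half-nonNeg (ℚ.<⇒≤ 0<ε)
        (a , d[ha,c]≤δ) = h-dense δ (half-pos 0<ε) c
        ga = extension (h a)
        fa* = singletonFamily B (f a)
        g′c→g′ha = to (g′-iso c (h a) δ 0≤δ) (PC.symmetric 0≤δ d[ha,c]≤δ)
        g′c→fa* = PB.dFam-trans {g′ c} {g′ (h a)} {fa*} 0≤δ ℚ.≤-refl g′c→g′ha (g′-extends a)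
        g′c→ga = PB.dFam-trans {g′ c} {fa*} {ga} (+-nonNeg 0≤δ ℚ.≤-refl) ℚ.≤-refl
                   g′c→fa* (PB.dFam-sym {ga} {fa*} {0ℚ} (extension-extends a))
        g′c→gc = PB.dFam-trans {g′ c} {ga} {extension c} (+-nonNeg (+-nonNeg 0≤δ ℚ.≤-refl) ℚ.≤-refl) 0≤δ
                   g′c→ga (extension-nonexpanding 0≤δ d[ha,c]≤δ)
    in subst (dFam B (g′ c) (extension c)) (regroup ε) g′c→gc
    where
      open +-*-Solver
      regroup : ∀ ε → half ε + 0ℚ + 0ℚ + half ε ≡ ε
      regroup = solve 1 (λ ε → ε :* con ½ :+ con 0ℚ :+ con 0ℚ :+ ε :* con ½ := ε) refl

theorem3p2 : (A B C : PremetricSpace)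
    (f : Carrier A → Carrier B) (h : Carrier A → Carrier C) →
    IsIsometricEmbedding (d A) (d B) f →
    IsIsometricEmbedding (d A) (d C) h →
    HasDenseImage (d C) h →
    ∃[ g ] (IsIsometricEmbedding (d C) (dFam B) g
           × (∀ a → _~_ B (g (h a)) (singletonFamily B (f a)))
           × (∀ (g′ : Carrier C → CauchyFamily B) →
                IsIsometricEmbedding (d C) (dFam B) g′ →
                (∀ a → _~_ B (g′ (h a)) (singletonFamily B (f a))) →
                ∀ c → _~_ B (g′ c) (g c)))
theorem3p2 A B C f h f-iso h-iso h-dense =
  extension , extension-isometric , extension-extends , extension-unique
  where open Extension A B C f h f-iso h-iso h-dense
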